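{- For every positive integer $n$, the graph $\Phi(\mathbb H(\mathbb Z_{2^n}))$ is not Eulerian.
   Context: $\mathbb H(\mathbb Z_{2^n})$ is the ring of Hamilton quaternions over $\mathbb Z_{2^n}$. Its elements are $a_1+a_2i+a_3j+a_4k$ with $a_i\in\mathbb Z_{2^n}$, written $(a_1,a_2,a_3,a_4)$. Addition is coordinatewise, and multiplication is determined by distributivity, scalars commuting with $i,j,k$, and $i^2=j^2=k^2=-1$, $ij=-ji=k$, $jk=-kj=i$, $ki=-ik=j$. For a ring $R$ with unity, the non-zero divisor graph $\Phi(R)$ is the simple graph with vertex set $R\setminus\{0,1,-1\}$ in which two distinct vertices $x,y$ are adjacent if and only if $xy\neq0$ or $yx\neq0$. A graph is Eulerian if it is connected and has a closed trail containing every edge. -}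

module Defs where

open import Data.Nat using (ℕ; suc; _+_; _*_; _∸_; _^_; NonZero)
open import Data.Nat.Properties using (m^n≢0)
open import Data.Nat.DivMod using (_mod_)
open import Data.Fin using (Fin; toℕ)
open import Data.Product using (_×_; _,_; ∃; Σ)
open import Data.Sum using (_⊎_)
open import Data.List using (List; []; _∷_)
open import Data.List.Relation.Unary.All using (All)
open import Data.List.Relation.Unary.Any using (Any)
open import Data.List.Relation.Unary.AllPairs using (AllPairs)
open import Relation.Nullary using (¬_)
open import Relation.Binary.PropositionalEquality using (_≡_; _≢_)

modulus : ℕ → ℕ
modulus n = 2 ^ n

modulus-nonZero : ∀ n → NonZero (2 ^ n)
modulus-nonZero n = m^n≢0 2 n

Zmod : ℕ → Set
Zmod n = Fin (2 ^ n)

module ZOps (n : ℕ) where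
  red : ℕ → Zmod n
  red a = _mod_ a (2 ^ n) {{modulus-nonZero n}}

  _⊕_ : Zmod n → Zmod n → Zmod n
  a ⊕ b = red (toℕ a + toℕ b)

  _⊗_ : Zmod n → Zmod n → Zmod n
  a ⊗ b = red (toℕ a * toℕ b)

  ⊝_ : Zmod n → Zmod n
  ⊝ a = red (2 ^ n ∸ toℕ a)

  _⊖_ : Zmod n → Zmod n → Zmod n
  a ⊖ b = a ⊕ (⊝ b)

  infixl 6 _⊕_ _⊖_
  infixl 7 _⊗_

-- Hamilton quaternions H(Z_{2^n}): a1 + a2 i + a3 j + a4 k

record Quat (n : ℕ) : Set where
  constructor quat
  field
    q1 q2 q3 q4 : Zmod n

module _ {n : ℕ} where
  open ZOps n

  0Q : Quat n
  0Q = quat (red 0) (red 0) (red 0) (red 0)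

  1Q : Quat n
  1Q = quat (red 1) (red 0) (red 0) (red 0)

  -1Q : Quat n
  -1Q = quat (⊝ red 1) (red 0) (red 0) (red 0)

  -- Hamilton product (i² = j² = k² = -1, ij = k, jk = i, ki = j)
  _·_ : Quat n → Quat n → Quat n
  quat a1 a2 a3 a4 · quat b1 b2 b3 b4 =
    quat (a1 ⊗ b1 ⊖ a2 ⊗ b2 ⊖ a3 ⊗ b3 ⊖ a4 ⊗ b4)
         (a1 ⊗ b2 ⊕ a2 ⊗ b1 ⊕ a3 ⊗ b4 ⊖ a4 ⊗ b3)
         (a1 ⊗ b3 ⊖ a2 ⊗ b4 ⊕ a3 ⊗ b1 ⊕ a4 ⊗ b2)
         (a1 ⊗ b4 ⊕ a2 ⊗ b3 ⊖ a3 ⊗ b2 ⊕ a4 ⊗ b1)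

record Graph : Set₁ where
  field
    V     : Set
    IsV   : V → Set
    Adj   : V → V → Set   -- assumed to relate only vertices (see Φ below)

module _ (G : Graph) where
  open Graph G

  steps : V → List V → List (V × V)
  steps v []       = []
  steps v (w ∷ ws) = (v , w) ∷ steps w ws

  endpoint : V → List V → V
  endpoint v []       = v
  endpoint v (w ∷ ws) = endpoint w ws

  SameEdge : V × V → V × V → Set
  SameEdge (a , b) (c , d) = (a ≡ c × b ≡ d) ⊎ (a ≡ d × b ≡ c)

  IsWalk : V → List V → Set
  IsWalk v ws = IsV v × All (λ e → Adj (Data.Product.proj₁ e) (Data.Product.proj₂ e)) (steps v ws)

  Connected : Set
  Connected = ∀ x y → IsV x → IsV y → ∃ λ ws → IsWalk x ws × endpoint x ws ≡ y

  IsClosedTrail : V → List V → Set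
  IsClosedTrail v ws = IsWalk v ws × endpoint v ws ≡ v × AllPairs (λ e f → ¬ SameEdge e f) (steps v ws)

  Eulerian : Set
  Eulerian = Connected × Σ _ λ v → ∃ λ ws → IsClosedTrail v ws
               × (∀ x y → Adj x y → Any (SameEdge (x , y)) (steps v ws))

IsVertexΦ : ∀ {n} → Quat n → Set
IsVertexΦ x = x ≢ 0Q × x ≢ 1Q × x ≢ -1Q

AdjΦ : ∀ {n} → Quat n → Quat n → Set
AdjΦ x y = IsVertexΦ x × IsVertexΦ y × x ≢ y × ((x · y ≢ 0Q) ⊎ (y · x ≢ 0Q))

Φ : ℕ → Graph
Φ n = record { V = Quat n ; IsV = IsVertexΦ ; Adj = AdjΦ }

{-# OPTIONS --safe #-}
-- Write x = 1 + i in ℍ(ℤ_{2^N}), N ≥ 1, and let S be the set of z with xz ≠ 0 or zx ≠ 0.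
-- The translation σ z = z + 2^(N-1) x is a fixed-point-free involution, and since x² = 2i and
-- 2 · 2^(N-1) = 0 we get x σ(z) = xz and σ(z) x = zx; so σ preserves S and |S| is even.
-- Besides the neighbours of x, S contains exactly 1, -1 and (when x² ≠ 0) x itself: three
-- elements when N ≥ 2, but only 1 when N = 1, where -1 = 1 and x² = 0. Either way x has odd
-- degree. But a closed trail through every edge enters x exactly as often as it leaves x,
-- each time along a new edge, so every vertex of an Eulerian graph has even degree.
module Submission where

open import Defs
open import Data.Nat as ℕ using (ℕ; zero; suc; _^_; _<_; _∸_; z≤n; s≤s)
import Data.Nat.Properties as ℕ
open import Data.Nat.DivMod using (_%_; _/_; m%n<n; m≡m%n+[m/n]*n)
open import Data.Nat.Divisibility
  using (_∣_; divides; _∣0; ∣-refl; ∣m∣n⇒∣m+n; ∣m+n∣m⇒∣n; >⇒∤; n∣m⇒m%n≡0)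
import Data.Nat.Tactic.RingSolver as ℕ-Solver
open import Data.Integer as ℤ using (ℤ; +_; 0ℤ; 1ℤ; _+_; _-_; _*_; -_; ∣_∣)
import Data.Integer.Properties as ℤ
open import Data.Integer.Divisibility.Signed as ℤ∣
  using () renaming (_∣_ to _∣ℤ_; divides to dividesℤ)
open import Data.Integer.Tactic.RingSolver using (solve-∀)
open import Data.Fin as Fin using (toℕ)
open import Data.Fin.Properties using (toℕ-fromℕ<; toℕ-injective; toℕ<n)
open import Data.List using (List; []; _∷_; length; filter; _++_)
open import Data.List.Properties using (filter-all; length-++)
open import Data.List.Relation.Unary.Any using (Any; here; there)
open import Data.List.Relation.Unary.All as All using (All; []; _∷_)
open import Data.List.Relation.Unary.AllPairs using (AllPairs; []; _∷_)
open import Data.List.Relation.Unary.Unique.Propositional using (Unique)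
import Data.List.Relation.Unary.Unique.Propositional.Properties as Unique
open import Data.List.Relation.Binary.Disjoint.Propositional using (Disjoint)
open import Data.List.Membership.Propositional using (_∈_)
open import Data.List.Membership.Propositional.Properties
  using (∈-filter⁺; ∈-filter⁻; ∈-++⁺ˡ; ∈-++⁺ʳ; ∈-++⁻)
open import Data.Product using (_×_; _,_; proj₁; proj₂; ∃; -,_)
open import Data.Sum using (_⊎_; inj₁; inj₂; [_,_]′)
open import Function using (_∘_; _∘′_)
open import Relation.Nullary using (¬_; Dec; yes; no; ¬?; contradiction)
open import Relation.Nullary.Decidable using (map′; _×-dec_)
open import Relation.Binary.Bundles using (Setoid)
import Relation.Binary.Reasoning.Setoid as SetoidReasoning
open import Relation.Binary.Definitions using (DecidableEquality)
open import Relation.Binary.PropositionalEquality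

-- Lists closed under a fixed-point-free involution

module _ {A : Set} (_≟_ : DecidableEquality A) where

  without : A → List A → List A
  without y = filter (λ z → ¬? (z ≟ y))

  length-without : ∀ {y xs} → Unique xs → y ∈ xs → length xs ≡ suc (length (without y xs))
  length-without {y} {z ∷ xs} (z∉xs ∷ _) y∈ with z ≟ y
  ... | yes refl = cong (suc ∘′ length) (sym (filter-all (λ w → ¬? (w ≟ z)) (All.map (_∘′ sym) z∉xs)))
  length-without {y} {z ∷ xs} (_ ∷ _) (here refl) | no z≢y = contradiction refl z≢y
  length-without {y} {z ∷ xs} (_ ∷ u) (there y∈) | no _ = cong suc (length-without u y∈)

  module _ (σ : A → A) (σ-involutive : ∀ a → σ (σ a) ≡ a) (σ-fixpoint-free : ∀ a → σ a ≢ a) where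

    Closed : List A → Set
    Closed xs = ∀ {a} → a ∈ xs → σ a ∈ xs

    σ-swap : ∀ {a b} → σ a ≡ b → a ≡ σ b
    σ-swap {a} refl = sym (σ-involutive a)

    private
      -- Recursion on the length n, since the recursive call is on a filtered tail.
      pair-off : ∀ n xs → length xs ≡ n → Unique xs → Closed xs → 2 ∣ n
      pair-off zero [] _ _ _ = 2 ∣0
      pair-off (suc n) (a ∷ xs) len (a∉xs ∷ u) closed =
        pair-off-rest n (trans (sym (length-without u σa∈xs)) (ℕ.suc-injective len))
        where
        σa∈xs : σ a ∈ xs
        σa∈xs with closed (here refl)
        ... | here σa≡a = contradiction σa≡a (σ-fixpoint-free a)
        ... | there σa∈xs = σa∈xs

        rest = without (σ a) xs

        closed-rest : Closed rest
        closed-rest {z} z∈rest with ∈-filter⁻ _ z∈rest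
        ... | z∈xs , z≢σa with closed (there z∈xs)
        ...   | here σz≡a = contradiction (σ-swap σz≡a) z≢σa
        ...   | there σz∈xs = ∈-filter⁺ _ σz∈xs λ σz≡σa →
                All.lookup a∉xs z∈xs (sym (trans (σ-swap σz≡σa) (σ-involutive a)))

        pair-off-rest : ∀ n → suc (length rest) ≡ n → 2 ∣ suc n
        pair-off-rest (suc m) eq =
          ∣m∣n⇒∣m+n ∣-refl (pair-off m rest (ℕ.suc-injective eq) (Unique.filter⁺ _ u) closed-rest)

    closed⇒even-length : ∀ {xs} → Unique xs → Closed xs → 2 ∣ length xs
    closed⇒even-length = pair-off _ _ refl

    even-length-complement : ∀ xs ys → Unique xs → Unique ys → Disjoint xs ys → Closed (xs ++ ys) →
      2 ∣ length xs → 2 ∣ length ys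
    even-length-complement xs ys unique-xs unique-ys disjoint closed 2∣xs = ∣m+n∣m⇒∣n
      (subst (2 ∣_) (length-++ xs) (closed⇒even-length (Unique.++⁺ unique-xs unique-ys disjoint) closed))
      2∣xs

-- Degrees in Eulerian graphs

Neighbourhood : (G : Graph) → Graph.V G → List (Graph.V G) → Set
Neighbourhood G x ns = Unique ns × (∀ {y} → y ∈ ns → Adj x y) × (∀ {y} → Adj x y → y ∈ ns)
  where open Graph G

module EulerianDegree (G : Graph) (_≟_ : DecidableEquality (Graph.V G)) where
  open Graph G

  Edge : Set
  Edge = V × V

  SameEdge-sym : ∀ {e f} → SameEdge G e f → SameEdge G f e
  SameEdge-sym (inj₁ (refl , refl)) = inj₁ (refl , refl)
  SameEdge-sym (inj₂ (refl , refl)) = inj₂ (refl , refl)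

  SameEdge-trans : ∀ {e f g} → SameEdge G e f → SameEdge G f g → SameEdge G e g
  SameEdge-trans (inj₁ (refl , refl)) q = q
  SameEdge-trans (inj₂ (refl , refl)) (inj₁ (refl , refl)) = inj₂ (refl , refl)
  SameEdge-trans (inj₂ (refl , refl)) (inj₂ (refl , refl)) = inj₁ (refl , refl)

  δ : V → V → ℕ
  δ a x with a ≟ x
  ... | yes _ = 1
  ... | no _  = 0

  leaving entering : V → List Edge → ℕ
  leaving  x []             = 0
  leaving  x ((a , _) ∷ es) = δ a x ℕ.+ leaving x es
  entering x []             = 0
  entering x ((_ , b) ∷ es) = δ b x ℕ.+ entering x es

  walk-balance : ∀ x v ws →
    leaving x (steps G v ws) ℕ.+ δ (endpoint G v ws) x ≡ entering x (steps G v ws) ℕ.+ δ v x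
  walk-balance x v []       = refl
  walk-balance x v (w ∷ ws) = begin
    δ v x ℕ.+ out ℕ.+ δ (endpoint G w ws) x   ≡⟨ ℕ.+-assoc (δ v x) out _ ⟩
    δ v x ℕ.+ (out ℕ.+ δ (endpoint G w ws) x) ≡⟨ cong (δ v x ℕ.+_) (walk-balance x w ws) ⟩
    δ v x ℕ.+ (in′ ℕ.+ δ w x)                 ≡⟨ rearrange (δ v x) in′ (δ w x) ⟩
    δ w x ℕ.+ in′ ℕ.+ δ v x                   ∎
    where
    open ≡-Reasoning
    out = leaving x (steps G w ws)
    in′ = entering x (steps G w ws)
    rearrange : ∀ a b c → a ℕ.+ (b ℕ.+ c) ≡ c ℕ.+ b ℕ.+ a
    rearrange = ℕ-Solver.solve-∀

  neighboursAlong : V → List Edge → List V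
  neighboursAlong x [] = []
  neighboursAlong x ((a , b) ∷ es) with a ≟ x | b ≟ x
  ... | yes _ | _     = b ∷ neighboursAlong x es
  ... | no _  | yes _ = a ∷ neighboursAlong x es
  ... | no _  | no _  = neighboursAlong x es

  length-neighboursAlong : ∀ x es → All (λ e → proj₁ e ≢ proj₂ e) es →
    length (neighboursAlong x es) ≡ leaving x es ℕ.+ entering x es
  length-neighboursAlong x [] _ = refl
  length-neighboursAlong x ((a , b) ∷ es) (a≢b ∷ loopless) with a ≟ x | b ≟ x
  ... | yes refl | yes refl = contradiction refl a≢b
  ... | yes _    | no _     = cong suc (length-neighboursAlong x es loopless)
  ... | no _     | yes _    = trans (cong suc (length-neighboursAlong x es loopless)) (sym (ℕ.+-suc _ _))
  ... | no _     | no _     = length-neighboursAlong x es loopless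

  ∈-neighboursAlong⁻ : ∀ {x y} es → y ∈ neighboursAlong x es → Any (SameEdge G (x , y)) es
  ∈-neighboursAlong⁻ {x} ((a , b) ∷ es) y∈ with a ≟ x | b ≟ x | y∈
  ... | yes refl | _        | here refl = here (inj₁ (refl , refl))
  ... | no _     | yes refl | here refl = here (inj₂ (refl , refl))
  ... | yes _    | _        | there y∈′ = there (∈-neighboursAlong⁻ es y∈′)
  ... | no _     | yes _    | there y∈′ = there (∈-neighboursAlong⁻ es y∈′)
  ... | no _     | no _     | y∈′       = there (∈-neighboursAlong⁻ es y∈′)

  ∈-neighboursAlong⁺ : ∀ {x y} es → x ≢ y → Any (SameEdge G (x , y)) es →
    y ∈ neighboursAlong x es
  ∈-neighboursAlong⁺ {x} ((a , b) ∷ es) x≢y e∈ with a ≟ x | b ≟ x | e∈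
  ... | yes _    | _        | here (inj₁ (_ , refl)) = here refl
  ... | yes refl | _        | here (inj₂ (_ , refl)) = contradiction refl x≢y
  ... | no a≢x   | _        | here (inj₁ (refl , _)) = contradiction refl a≢x
  ... | no _     | yes _    | here (inj₂ (_ , refl)) = here refl
  ... | no _     | no b≢x   | here (inj₂ (refl , _)) = contradiction refl b≢x
  ... | yes _    | _        | there e∈′ = there (∈-neighboursAlong⁺ es x≢y e∈′)
  ... | no _     | yes _    | there e∈′ = there (∈-neighboursAlong⁺ es x≢y e∈′)
  ... | no _     | no _     | there e∈′ = ∈-neighboursAlong⁺ es x≢y e∈′

  fresh-neighbour : ∀ {x y e} es → SameEdge G (x , y) e → All (λ f → ¬ SameEdge G e f) es →
    All (y ≢_) (neighboursAlong x es)
  fresh-neighbour es xy∼e new = All.tabulate λ z∈ → λ { refl →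
    let ¬e∼f , xy∼f = All.lookupAny new (∈-neighboursAlong⁻ es z∈)
    in ¬e∼f (SameEdge-trans (SameEdge-sym xy∼e) xy∼f) }

  neighboursAlong-unique : ∀ x es → AllPairs (λ e f → ¬ SameEdge G e f) es →
    Unique (neighboursAlong x es)
  neighboursAlong-unique x [] [] = []
  neighboursAlong-unique x ((a , b) ∷ es) (new ∷ norep) with a ≟ x | b ≟ x
  ... | yes refl | _        = fresh-neighbour es (inj₁ (refl , refl)) new ∷ neighboursAlong-unique x es norep
  ... | no _     | yes refl = fresh-neighbour es (inj₂ (refl , refl)) new ∷ neighboursAlong-unique x es norep
  ... | no _     | no _     = neighboursAlong-unique x es norep

  module _ (Adj-sym : ∀ {x y} → Adj x y → Adj y x) (Adj-irrefl : ∀ {x} → ¬ Adj x x) where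

    Adj-≢ : ∀ {x y} → Adj x y → x ≢ y
    Adj-≢ xy refl = Adj-irrefl xy

    Adj-along : ∀ {x y e} → SameEdge G (x , y) e → Adj (proj₁ e) (proj₂ e) → Adj x y
    Adj-along (inj₁ (refl , refl)) ab = ab
    Adj-along (inj₂ (refl , refl)) ab = Adj-sym ab

    eulerian⇒even-degree : Eulerian G → ∀ x → ∃ λ ns → Neighbourhood G x ns × 2 ∣ length ns
    eulerian⇒even-degree (_ , v , ws , ((_ , adjacent) , closed , norep) , covers) x =
      neighboursAlong x st , (neighboursAlong-unique x st norep , sound , complete) , even
      where
      st = steps G v ws

      sound : ∀ {y} → y ∈ neighboursAlong x st → Adj x y
      sound y∈ = let e-adj , xy∼e = All.lookupAny adjacent (∈-neighboursAlong⁻ st y∈)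
                 in Adj-along xy∼e e-adj

      complete : ∀ {y} → Adj x y → y ∈ neighboursAlong x st
      complete xy = ∈-neighboursAlong⁺ st (Adj-≢ xy) (covers x _ xy)

      balanced : leaving x st ≡ entering x st
      balanced = ℕ.+-cancelʳ-≡ (δ v x) _ _
        (subst (λ u → leaving x st ℕ.+ δ u x ≡ entering x st ℕ.+ δ v x) closed (walk-balance x v ws))

      even : 2 ∣ length (neighboursAlong x st)
      even = divides (leaving x st) (begin
        length (neighboursAlong x st) ≡⟨ length-neighboursAlong x st (All.map Adj-≢ adjacent) ⟩
        leaving x st ℕ.+ entering x st ≡⟨ cong (leaving x st ℕ.+_) (sym balanced) ⟩
        leaving x st ℕ.+ leaving x st  ≡⟨ double (leaving x st) ⟩
        leaving x st ℕ.* 2             ∎)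
        where
        open ≡-Reasoning
        double : ∀ m → m ℕ.+ m ≡ m ℕ.* 2
        double = ℕ-Solver.solve-∀

-- Arithmetic in ℤ_{2^N} through integer representatives

module Residues (N : ℕ) where
  open ZOps N

  M : ℕ
  M = 2 ^ N

  instance
    M-nonZero : ℕ.NonZero M
    M-nonZero = modulus-nonZero N

  -- A record rather than a function into _∣ℤ_, so that i and j can be inferred from a proof.
  infix 4 _≡ₘ_
  record _≡ₘ_ (i j : ℤ) : Set where
    constructor congruent
    field M∣i-j : + M ∣ℤ i - j

  private
    multiple-by : ∀ {x k l} → x ≡ k - l → + M ∣ℤ x → k ≡ₘ l
    multiple-by eq p = congruent (subst (+ M ∣ℤ_) eq p)

  ≡⇒≡ₘ : ∀ {i j} → i ≡ j → i ≡ₘ j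
  ≡⇒≡ₘ {i} refl = congruent (dividesℤ 0ℤ (ℤ.+-inverseʳ i))

  ≡ₘ-refl : ∀ {i} → i ≡ₘ i
  ≡ₘ-refl = ≡⇒≡ₘ refl

  ≡ₘ-sym : ∀ {i j} → i ≡ₘ j → j ≡ₘ i
  ≡ₘ-sym {i} {j} (congruent p) = multiple-by (lemma i j) (ℤ∣.∣m⇒∣-m p)
    where
    lemma : ∀ i j → - (i - j) ≡ j - i
    lemma = solve-∀

  ≡ₘ-trans : ∀ {i j k} → i ≡ₘ j → j ≡ₘ k → i ≡ₘ k
  ≡ₘ-trans {i} {j} {k} (congruent p) (congruent q) =
    multiple-by (lemma i j k) (ℤ∣.∣m∣n⇒∣m+n p q)
    where
    lemma : ∀ i j k → (i - j) + (j - k) ≡ i - k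
    lemma = solve-∀

  ≡ₘ-setoid : Setoid _ _
  ≡ₘ-setoid = record
    { Carrier = ℤ ; _≈_ = _≡ₘ_
    ; isEquivalence = record { refl = ≡ₘ-refl ; sym = ≡ₘ-sym ; trans = ≡ₘ-trans } }

  +-cong-≡ₘ : ∀ {i j k l} → i ≡ₘ j → k ≡ₘ l → i + k ≡ₘ j + l
  +-cong-≡ₘ {i} {j} {k} {l} (congruent p) (congruent q) =
    multiple-by (lemma i j k l) (ℤ∣.∣m∣n⇒∣m+n p q)
    where
    lemma : ∀ i j k l → (i - j) + (k - l) ≡ (i + k) - (j + l)
    lemma = solve-∀

  neg-cong-≡ₘ : ∀ {i j} → i ≡ₘ j → - i ≡ₘ - j
  neg-cong-≡ₘ {i} {j} (congruent p) = multiple-by (lemma i j) (ℤ∣.∣m⇒∣-m p)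
    where
    lemma : ∀ i j → - (i - j) ≡ - i - - j
    lemma = solve-∀

  *-cong-≡ₘ : ∀ {i j k l} → i ≡ₘ j → k ≡ₘ l → i * k ≡ₘ j * l
  *-cong-≡ₘ {i} {j} {k} {l} (congruent p) (congruent q) =
    multiple-by (lemma i j k l) (ℤ∣.∣m∣n⇒∣m+n (ℤ∣.∣n⇒∣m*n i q) (ℤ∣.∣m⇒∣m*n l p))
    where
    lemma : ∀ i j k l → i * (k - l) + (i - j) * l ≡ i * k - j * l
    lemma = solve-∀

  small-multiple≡0 : ∀ {i} → + M ∣ℤ i → ∣ i ∣ < M → i ≡ 0ℤ
  small-multiple≡0 {i} M∣i ∣i∣<M with ∣ i ∣ in eq | ℤ∣.∣⇒∣ᵤ M∣i
  ... | zero  | _    = ℤ.∣i∣≡0⇒i≡0 eq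
  ... | suc _ | M∣∣i∣ = contradiction M∣∣i∣ (>⇒∤ ∣i∣<M)

  ⟦_⟧ : Zmod N → ℤ
  ⟦ a ⟧ = + toℕ a

  ⟦red⟧ : ∀ m → ⟦ red m ⟧ ≡ₘ + m
  ⟦red⟧ m rewrite toℕ-fromℕ< (m%n<n m M) = ≡ₘ-sym (congruent (dividesℤ (+ q) (begin
      + m - + r               ≡⟨ cong (_- + r) m≡r+qM ⟩
      + r + + q * + M - + r   ≡⟨ lemma (+ r) (+ q * + M) ⟩
      + q * + M               ∎)))
    where
    open ≡-Reasoning
    r = m % M
    q = m / M
    m≡r+qM : + m ≡ + r + + q * + M
    m≡r+qM = begin
      + m                ≡⟨ cong +_ (m≡m%n+[m/n]*n m M) ⟩
      + (r ℕ.+ q ℕ.* M)  ≡⟨ ℤ.pos-+ r (q ℕ.* M) ⟩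
      + r + + (q ℕ.* M)  ≡⟨ cong (λ k → + r + k) (ℤ.pos-* q M) ⟩
      + r + + q * + M    ∎
    lemma : ∀ r k → r + k - r ≡ k
    lemma = solve-∀

  ⟦⊕⟧ : ∀ a b → ⟦ a ⊕ b ⟧ ≡ₘ ⟦ a ⟧ + ⟦ b ⟧
  ⟦⊕⟧ a b = ≡ₘ-trans (⟦red⟧ _) (≡⇒≡ₘ (ℤ.pos-+ (toℕ a) (toℕ b)))

  ⟦⊗⟧ : ∀ a b → ⟦ a ⊗ b ⟧ ≡ₘ ⟦ a ⟧ * ⟦ b ⟧
  ⟦⊗⟧ a b = ≡ₘ-trans (⟦red⟧ _) (≡⇒≡ₘ (ℤ.pos-* (toℕ a) (toℕ b)))

  ⟦⊝⟧ : ∀ a → ⟦ ⊝ a ⟧ ≡ₘ - ⟦ a ⟧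
  ⟦⊝⟧ a = ≡ₘ-trans (⟦red⟧ (M ∸ toℕ a)) (congruent (dividesℤ 1ℤ (begin
      + (M ∸ toℕ a) - - ⟦ a ⟧   ≡⟨ cong (_+_ (+ (M ∸ toℕ a))) (ℤ.neg-involutive ⟦ a ⟧) ⟩
      + (M ∸ toℕ a) + ⟦ a ⟧     ≡⟨ ℤ.pos-+ (M ∸ toℕ a) (toℕ a) ⟨
      + (M ∸ toℕ a ℕ.+ toℕ a)   ≡⟨ cong +_ (ℕ.m∸n+n≡m (ℕ.<⇒≤ (toℕ<n a))) ⟩
      + M                       ≡⟨ ℤ.*-identityˡ (+ M) ⟨
      1ℤ * + M                  ∎)))
    where open ≡-Reasoning

  ⟦⊖⟧ : ∀ a b → ⟦ a ⊖ b ⟧ ≡ₘ ⟦ a ⟧ - ⟦ b ⟧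
  ⟦⊖⟧ a b = ≡ₘ-trans (⟦⊕⟧ a (⊝ b)) (+-cong-≡ₘ (≡ₘ-refl {⟦ a ⟧}) (⟦⊝⟧ b))

  ⟦⟧-injective : ∀ {a b} → ⟦ a ⟧ ≡ₘ ⟦ b ⟧ → a ≡ b
  ⟦⟧-injective {a} {b} (congruent p) =
    toℕ-injective (ℤ.+-injective (ℤ.i-j≡0⇒i≡j ⟦ a ⟧ ⟦ b ⟧ (small-multiple≡0 p ∣a-b∣<M)))
    where
    ∣a-b∣<M : ∣ ⟦ a ⟧ - ⟦ b ⟧ ∣ < M
    ∣a-b∣<M = begin-strict
      ∣ ⟦ a ⟧ - ⟦ b ⟧ ∣        ≡⟨ cong ∣_∣ (ℤ.m-n≡m⊖n (toℕ a) (toℕ b)) ⟩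
      ∣ toℕ a ℤ.⊖ toℕ b ∣      ≤⟨ ℤ.∣m⊝n∣≤m⊔n (toℕ a) (toℕ b) ⟩
      toℕ a ℕ.⊔ toℕ b          <⟨ ℕ.⊔-lub (toℕ<n a) (toℕ<n b) ⟩
      M                        ∎
      where open ℕ.≤-Reasoning

  small-difference⇒≢ₘ : ∀ {i j} → 0 < ∣ i - j ∣ → ∣ i - j ∣ < M → ¬ i ≡ₘ j
  small-difference⇒≢ₘ {i} {j} 0<∣i-j∣ ∣i-j∣<M (congruent p) =
    ℕ.<⇒≢ 0<∣i-j∣ (sym (cong ∣_∣ (small-multiple≡0 p ∣i-j∣<M)))

  ⟦⟧-≢ : ∀ {a b i j} → ⟦ a ⟧ ≡ₘ i → ⟦ b ⟧ ≡ₘ j → ¬ i ≡ₘ j → a ≢ b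
  ⟦⟧-≢ a≡i b≡j i≢j refl = i≢j (≡ₘ-trans (≡ₘ-sym a≡i) b≡j)

  M≡ₘ0 : + M ≡ₘ 0ℤ
  M≡ₘ0 = congruent (dividesℤ 1ℤ (trans (ℤ.+-identityʳ (+ M)) (sym (ℤ.*-identityˡ (+ M)))))

  module ≡ₘ-Reasoning = SetoidReasoning ≡ₘ-setoid

  0# 1# : Zmod N
  0# = red 0
  1# = red 1

  ⊕-identityˡ : ∀ a → 0# ⊕ a ≡ a
  ⊕-identityˡ a = ⟦⟧-injective (begin
    ⟦ 0# ⊕ a ⟧      ≈⟨ ⟦⊕⟧ 0# a ⟩
    ⟦ 0# ⟧ + ⟦ a ⟧  ≈⟨ +-cong-≡ₘ (⟦red⟧ 0) (≡ₘ-refl {⟦ a ⟧}) ⟩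
    0ℤ + ⟦ a ⟧      ≡⟨ ℤ.+-identityˡ ⟦ a ⟧ ⟩
    ⟦ a ⟧           ∎)
    where open ≡ₘ-Reasoning

  ⊕-identityʳ : ∀ a → a ⊕ 0# ≡ a
  ⊕-identityʳ a = ⟦⟧-injective (begin
    ⟦ a ⊕ 0# ⟧      ≈⟨ ⟦⊕⟧ a 0# ⟩
    ⟦ a ⟧ + ⟦ 0# ⟧  ≈⟨ +-cong-≡ₘ (≡ₘ-refl {⟦ a ⟧}) (⟦red⟧ 0) ⟩
    ⟦ a ⟧ + 0ℤ      ≡⟨ ℤ.+-identityʳ ⟦ a ⟧ ⟩
    ⟦ a ⟧           ∎)
    where open ≡ₘ-Reasoning

  ⊖-identityʳ : ∀ a → a ⊖ 0# ≡ a
  ⊖-identityʳ a = ⟦⟧-injective (begin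
    ⟦ a ⊖ 0# ⟧      ≈⟨ ⟦⊖⟧ a 0# ⟩
    ⟦ a ⟧ - ⟦ 0# ⟧  ≈⟨ +-cong-≡ₘ (≡ₘ-refl {⟦ a ⟧}) (neg-cong-≡ₘ (⟦red⟧ 0)) ⟩
    ⟦ a ⟧ - 0ℤ      ≡⟨ ℤ.+-identityʳ ⟦ a ⟧ ⟩
    ⟦ a ⟧           ∎)
    where open ≡ₘ-Reasoning

  ⊗-identityˡ : ∀ a → 1# ⊗ a ≡ a
  ⊗-identityˡ a = ⟦⟧-injective (begin
    ⟦ 1# ⊗ a ⟧      ≈⟨ ⟦⊗⟧ 1# a ⟩
    ⟦ 1# ⟧ * ⟦ a ⟧  ≈⟨ *-cong-≡ₘ (⟦red⟧ 1) (≡ₘ-refl {⟦ a ⟧}) ⟩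
    1ℤ * ⟦ a ⟧      ≡⟨ ℤ.*-identityˡ ⟦ a ⟧ ⟩
    ⟦ a ⟧           ∎)
    where open ≡ₘ-Reasoning

  ⊗-identityʳ : ∀ a → a ⊗ 1# ≡ a
  ⊗-identityʳ a = ⟦⟧-injective (begin
    ⟦ a ⊗ 1# ⟧      ≈⟨ ⟦⊗⟧ a 1# ⟩
    ⟦ a ⟧ * ⟦ 1# ⟧  ≈⟨ *-cong-≡ₘ (≡ₘ-refl {⟦ a ⟧}) (⟦red⟧ 1) ⟩
    ⟦ a ⟧ * 1ℤ      ≡⟨ ℤ.*-identityʳ ⟦ a ⟧ ⟩
    ⟦ a ⟧           ∎)
    where open ≡ₘ-Reasoning

  ⊗-zeroˡ : ∀ a → 0# ⊗ a ≡ 0#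
  ⊗-zeroˡ a = ⟦⟧-injective (begin
    ⟦ 0# ⊗ a ⟧      ≈⟨ ⟦⊗⟧ 0# a ⟩
    ⟦ 0# ⟧ * ⟦ a ⟧  ≈⟨ *-cong-≡ₘ (⟦red⟧ 0) (≡ₘ-refl {⟦ a ⟧}) ⟩
    0ℤ              ≈⟨ ⟦red⟧ 0 ⟨
    ⟦ 0# ⟧          ∎)
    where open ≡ₘ-Reasoning

  ⊗-zeroʳ : ∀ a → a ⊗ 0# ≡ 0#
  ⊗-zeroʳ a = ⟦⟧-injective (begin
    ⟦ a ⊗ 0# ⟧      ≈⟨ ⟦⊗⟧ a 0# ⟩
    ⟦ a ⟧ * ⟦ 0# ⟧  ≈⟨ *-cong-≡ₘ (≡ₘ-refl {⟦ a ⟧}) (⟦red⟧ 0) ⟩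
    ⟦ a ⟧ * 0ℤ      ≡⟨ ℤ.*-zeroʳ ⟦ a ⟧ ⟩
    0ℤ              ≈⟨ ⟦red⟧ 0 ⟨
    ⟦ 0# ⟧          ∎)
    where open ≡ₘ-Reasoning

  module _ {h} (h⊕h≡0 : h ⊕ h ≡ 0#) where
    private
      2h≡ₘ0 : ⟦ h ⟧ + ⟦ h ⟧ ≡ₘ 0ℤ
      2h≡ₘ0 = ≡ₘ-trans (≡ₘ-sym (⟦⊕⟧ h h)) (subst (λ c → ⟦ c ⟧ ≡ₘ 0ℤ) (sym h⊕h≡0) (⟦red⟧ 0))

    ⊕h-⊖-⊕h : ∀ a b → (a ⊕ h) ⊖ (b ⊕ h) ≡ a ⊖ b
    ⊕h-⊖-⊕h a b = ⟦⟧-injective (begin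
      ⟦ (a ⊕ h) ⊖ (b ⊕ h) ⟧                   ≈⟨ ⟦⊖⟧ (a ⊕ h) (b ⊕ h) ⟩
      ⟦ a ⊕ h ⟧ - ⟦ b ⊕ h ⟧                   ≈⟨ +-cong-≡ₘ (⟦⊕⟧ a h) (neg-cong-≡ₘ (⟦⊕⟧ b h)) ⟩
      (⟦ a ⟧ + ⟦ h ⟧) - (⟦ b ⟧ + ⟦ h ⟧)       ≡⟨ lemma ⟦ a ⟧ ⟦ b ⟧ ⟦ h ⟧ ⟩
      ⟦ a ⟧ - ⟦ b ⟧                           ≈⟨ ⟦⊖⟧ a b ⟨
      ⟦ a ⊖ b ⟧                               ∎)
      where
      open ≡ₘ-Reasoning
      lemma : ∀ a b h → (a + h) - (b + h) ≡ a - b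
      lemma = solve-∀

    ⊕h-⊕-⊕h : ∀ a b → (a ⊕ h) ⊕ (b ⊕ h) ≡ a ⊕ b
    ⊕h-⊕-⊕h a b = ⟦⟧-injective (begin
      ⟦ (a ⊕ h) ⊕ (b ⊕ h) ⟧                   ≈⟨ ⟦⊕⟧ (a ⊕ h) (b ⊕ h) ⟩
      ⟦ a ⊕ h ⟧ + ⟦ b ⊕ h ⟧                   ≈⟨ +-cong-≡ₘ (⟦⊕⟧ a h) (⟦⊕⟧ b h) ⟩
      (⟦ a ⟧ + ⟦ h ⟧) + (⟦ b ⟧ + ⟦ h ⟧)       ≡⟨ lemma ⟦ a ⟧ ⟦ b ⟧ ⟦ h ⟧ ⟩
      (⟦ a ⟧ + ⟦ b ⟧) + (⟦ h ⟧ + ⟦ h ⟧)       ≈⟨ +-cong-≡ₘ (≡ₘ-refl {⟦ a ⟧ + ⟦ b ⟧}) 2h≡ₘ0 ⟩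
      (⟦ a ⟧ + ⟦ b ⟧) + 0ℤ                    ≡⟨ ℤ.+-identityʳ _ ⟩
      ⟦ a ⟧ + ⟦ b ⟧                           ≈⟨ ⟦⊕⟧ a b ⟨
      ⟦ a ⊕ b ⟧                               ∎)
      where
      open ≡ₘ-Reasoning
      lemma : ∀ a b h → (a + h) + (b + h) ≡ (a + b) + (h + h)
      lemma = solve-∀

    ⊕h-involutive : ∀ a → (a ⊕ h) ⊕ h ≡ a
    ⊕h-involutive a = ⟦⟧-injective (begin
      ⟦ (a ⊕ h) ⊕ h ⟧                         ≈⟨ ⟦⊕⟧ (a ⊕ h) h ⟩
      ⟦ a ⊕ h ⟧ + ⟦ h ⟧                       ≈⟨ +-cong-≡ₘ (⟦⊕⟧ a h) (≡ₘ-refl {⟦ h ⟧}) ⟩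
      (⟦ a ⟧ + ⟦ h ⟧) + ⟦ h ⟧                 ≡⟨ ℤ.+-assoc ⟦ a ⟧ ⟦ h ⟧ ⟦ h ⟧ ⟩
      ⟦ a ⟧ + (⟦ h ⟧ + ⟦ h ⟧)                 ≈⟨ +-cong-≡ₘ (≡ₘ-refl {⟦ a ⟧}) 2h≡ₘ0 ⟩
      ⟦ a ⟧ + 0ℤ                              ≡⟨ ℤ.+-identityʳ _ ⟩
      ⟦ a ⟧                                   ∎)
      where open ≡ₘ-Reasoning

  a⊕h≢a : ∀ {h} a → h ≢ 0# → a ⊕ h ≢ a
  a⊕h≢a {h} a h≢0 a+h≡a = h≢0 (⟦⟧-injective (begin
    ⟦ h ⟧                     ≡⟨ lemma ⟦ a ⟧ ⟦ h ⟧ ⟩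
    (⟦ a ⟧ + ⟦ h ⟧) - ⟦ a ⟧   ≈⟨ +-cong-≡ₘ (⟦⊕⟧ a h) (≡ₘ-refl { - ⟦ a ⟧}) ⟨
    ⟦ a ⊕ h ⟧ - ⟦ a ⟧         ≡⟨ cong (λ c → ⟦ c ⟧ - ⟦ a ⟧) a+h≡a ⟩
    ⟦ a ⟧ - ⟦ a ⟧             ≡⟨ ℤ.+-inverseʳ ⟦ a ⟧ ⟩
    0ℤ                        ≈⟨ ⟦red⟧ 0 ⟨
    ⟦ 0# ⟧                    ∎))
    where
    open ≡ₘ-Reasoning
    lemma : ∀ a h → h ≡ (a + h) - a
    lemma = solve-∀

  ⟦⊝1#⟧ : ⟦ ⊝ 1# ⟧ ≡ₘ - 1ℤ
  ⟦⊝1#⟧ = ≡ₘ-trans (⟦⊝⟧ 1#) (neg-cong-≡ₘ (⟦red⟧ 1))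

  1#≢0# : 1 < M → 1# ≢ 0#
  1#≢0# 1<M = ⟦⟧-≢ (⟦red⟧ 1) (⟦red⟧ 0) (small-difference⇒≢ₘ (s≤s z≤n) 1<M)

  ⊝1#≢0# : 1 < M → ⊝ 1# ≢ 0#
  ⊝1#≢0# 1<M = ⟦⟧-≢ ⟦⊝1#⟧ (⟦red⟧ 0) (small-difference⇒≢ₘ (s≤s z≤n) 1<M)

  1#⊕1#≢0# : 2 < M → 1# ⊕ 1# ≢ 0#
  1#⊕1#≢0# 2<M =
    ⟦⟧-≢ (≡ₘ-trans (⟦⊕⟧ 1# 1#) (+-cong-≡ₘ (⟦red⟧ 1) (⟦red⟧ 1))) (⟦red⟧ 0)
      (small-difference⇒≢ₘ (s≤s z≤n) 2<M)

  1#≢⊝1# : 2 < M → 1# ≢ ⊝ 1#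
  1#≢⊝1# 2<M = ⟦⟧-≢ (⟦red⟧ 1) ⟦⊝1#⟧ (small-difference⇒≢ₘ (s≤s z≤n) 2<M)

-- Quaternions and the element 1 + i

_≟_ : ∀ {N} → DecidableEquality (Quat N)
quat a b c d ≟ quat a′ b′ c′ d′ =
  map′ (λ { (refl , refl , refl , refl) → refl }) (λ { refl → refl , refl , refl , refl })
       (a Fin.≟ a′ ×-dec b Fin.≟ b′ ×-dec c Fin.≟ c′ ×-dec d Fin.≟ d′)

NonZeroProduct : ∀ {N} → Quat N → Quat N → Set
NonZeroProduct x z = (x · z ≢ 0Q) ⊎ (z · x ≢ 0Q)

AdjΦ-sym : ∀ {N} {x y : Quat N} → AdjΦ x y → AdjΦ y x
AdjΦ-sym (vx , vy , x≢y , nz) = vy , vx , x≢y ∘ sym , [ inj₂ , inj₁ ]′ nz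

AdjΦ-irrefl : ∀ {N} {x : Quat N} → ¬ AdjΦ x x
AdjΦ-irrefl (_ , _ , x≢x , _) = x≢x refl

1+i : ∀ {N} → Quat N
1+i {N} = quat (red 1) (red 1) (red 0) (red 0)
  where open ZOps N

module QuaternionFacts (N : ℕ) where
  open ZOps N
  open Residues N

  quat-cong : ∀ {a a′ b b′ c c′ d d′ : Zmod N} → a ≡ a′ → b ≡ b′ → c ≡ c′ → d ≡ d′ →
    quat {N} a b c d ≡ quat a′ b′ c′ d′
  quat-cong refl refl refl refl = refl

  1+i·-expand : ∀ a b c d → 1+i {N} · quat a b c d ≡ quat (a ⊖ b) (b ⊕ a) (c ⊖ d) (d ⊕ c)
  1+i·-expand a b c d = quat-cong
    (trans (⊖-0#⊗ _ d) (trans (⊖-0#⊗ _ c) (cong₂ _⊖_ (⊗-identityˡ a) (⊗-identityˡ b))))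
    (trans (⊖-0#⊗ _ c) (trans (⊕-0#⊗ _ d) (cong₂ _⊕_ (⊗-identityˡ b) (⊗-identityˡ a))))
    (trans (⊕-0#⊗ _ b) (trans (⊕-0#⊗ _ a) (cong₂ _⊖_ (⊗-identityˡ c) (⊗-identityˡ d))))
    (trans (⊕-0#⊗ _ a) (trans (⊖-0#⊗ _ b) (cong₂ _⊕_ (⊗-identityˡ d) (⊗-identityˡ c))))
    where
    ⊖-0#⊗ : ∀ x y → x ⊖ 0# ⊗ y ≡ x
    ⊖-0#⊗ x y = trans (cong (x ⊖_) (⊗-zeroˡ y)) (⊖-identityʳ x)
    ⊕-0#⊗ : ∀ x y → x ⊕ 0# ⊗ y ≡ x
    ⊕-0#⊗ x y = trans (cong (x ⊕_) (⊗-zeroˡ y)) (⊕-identityʳ x)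

  ·1+i-expand : ∀ a b c d → quat a b c d · 1+i {N} ≡ quat (a ⊖ b) (a ⊕ b) (c ⊕ d) (0# ⊖ c ⊕ d)
  ·1+i-expand a b c d = quat-cong
    (trans (⊖-⊗0# _ d) (trans (⊖-⊗0# _ c) (cong₂ _⊖_ (⊗-identityʳ a) (⊗-identityʳ b))))
    (trans (⊖-⊗0# _ d) (trans (⊕-⊗0# _ c) (cong₂ _⊕_ (⊗-identityʳ a) (⊗-identityʳ b))))
    (cong₂ _⊕_ (trans (cong₂ _⊕_ a0-b0 (⊗-identityʳ c)) (⊕-identityˡ c)) (⊗-identityʳ d))
    (cong₂ _⊕_ (cong₂ _⊖_ a0+b0 (⊗-identityʳ c)) (⊗-identityʳ d))
    where
    ⊖-⊗0# : ∀ x y → x ⊖ y ⊗ 0# ≡ x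
    ⊖-⊗0# x y = trans (cong (x ⊖_) (⊗-zeroʳ y)) (⊖-identityʳ x)
    ⊕-⊗0# : ∀ x y → x ⊕ y ⊗ 0# ≡ x
    ⊕-⊗0# x y = trans (cong (x ⊕_) (⊗-zeroʳ y)) (⊕-identityʳ x)
    a0-b0 : a ⊗ 0# ⊖ b ⊗ 0# ≡ 0#
    a0-b0 = trans (⊖-⊗0# _ b) (⊗-zeroʳ a)
    a0+b0 : a ⊗ 0# ⊕ b ⊗ 0# ≡ 0#
    a0+b0 = trans (⊕-⊗0# _ b) (⊗-zeroʳ a)

  -- shift h y = y + h (1 + i)
  shift : Zmod N → Quat N → Quat N
  shift h (quat a b c d) = quat (a ⊕ h) (b ⊕ h) c d

  module _ {h} (h⊕h≡0 : h ⊕ h ≡ 0#) where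

    1+i·shift : ∀ y → 1+i · shift h y ≡ 1+i · y
    1+i·shift (quat a b c d) = begin
      1+i · quat (a ⊕ h) (b ⊕ h) c d
        ≡⟨ 1+i·-expand (a ⊕ h) (b ⊕ h) c d ⟩
      quat ((a ⊕ h) ⊖ (b ⊕ h)) ((b ⊕ h) ⊕ (a ⊕ h)) (c ⊖ d) (d ⊕ c)
        ≡⟨ quat-cong (⊕h-⊖-⊕h h⊕h≡0 a b) (⊕h-⊕-⊕h h⊕h≡0 b a) refl refl ⟩
      quat (a ⊖ b) (b ⊕ a) (c ⊖ d) (d ⊕ c)
        ≡⟨ 1+i·-expand a b c d ⟨
      1+i · quat a b c d
        ∎
      where open ≡-Reasoning

    shift·1+i : ∀ y → shift h y · 1+i ≡ y · 1+i
    shift·1+i (quat a b c d) = begin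
      quat (a ⊕ h) (b ⊕ h) c d · 1+i
        ≡⟨ ·1+i-expand (a ⊕ h) (b ⊕ h) c d ⟩
      quat ((a ⊕ h) ⊖ (b ⊕ h)) ((a ⊕ h) ⊕ (b ⊕ h)) (c ⊕ d) (0# ⊖ c ⊕ d)
        ≡⟨ quat-cong (⊕h-⊖-⊕h h⊕h≡0 a b) (⊕h-⊕-⊕h h⊕h≡0 a b) refl refl ⟩
      quat (a ⊖ b) (a ⊕ b) (c ⊕ d) (0# ⊖ c ⊕ d)
        ≡⟨ ·1+i-expand a b c d ⟨
      quat a b c d · 1+i
        ∎
      where open ≡-Reasoning

    shift-involutive : ∀ y → shift h (shift h y) ≡ y
    shift-involutive (quat a b c d) =
      quat-cong (⊕h-involutive h⊕h≡0 a) (⊕h-involutive h⊕h≡0 b) refl refl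

  shift-fixpoint-free : ∀ {h} → h ≢ 0# → ∀ y → shift h y ≢ y
  shift-fixpoint-free h≢0 (quat a _ _ _) eq = a⊕h≢a a h≢0 (cong Quat.q1 eq)

-- The degree of 1 + i in Φ(ℍ(ℤ_{2^(n+1)}))

module OddDegree (n : ℕ) where
  open ZOps (suc n)
  open Residues (suc n)
  open QuaternionFacts (suc n)

  H : ℕ
  H = 2 ^ n

  0<H : 0 < H
  0<H = ℕ.m^n>0 2 n

  1<M : 1 < M
  1<M = ℕ.*-monoʳ-≤ 2 0<H

  h : Zmod (suc n)
  h = red H

  h⊕h≡0 : h ⊕ h ≡ 0#
  h⊕h≡0 = ⟦⟧-injective (begin
    ⟦ h ⊕ h ⟧        ≈⟨ ⟦⊕⟧ h h ⟩
    ⟦ h ⟧ + ⟦ h ⟧    ≈⟨ +-cong-≡ₘ (⟦red⟧ H) (⟦red⟧ H) ⟩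
    + H + + H        ≡⟨ ℤ.pos-+ H H ⟨
    + (H ℕ.+ H)      ≡⟨ cong (λ k → + (H ℕ.+ k)) (ℕ.+-identityʳ H) ⟨
    + M              ≈⟨ M≡ₘ0 ⟩
    0ℤ               ≈⟨ ⟦red⟧ 0 ⟨
    ⟦ 0# ⟧           ∎)
    where open ≡ₘ-Reasoning

  h≢0 : h ≢ 0#
  h≢0 = ⟦⟧-≢ (⟦red⟧ H) (⟦red⟧ 0) (small-difference⇒≢ₘ 0<H+0 (ℕ.+-monoʳ-< H 0<H+0))
    where
    0<H+0 : 0 < H ℕ.+ 0
    0<H+0 = ℕ.≤-trans 0<H (ℕ.m≤m+n H 0)

  σ : Quat (suc n) → Quat (suc n)
  σ = shift h

  σ-involutive : ∀ z → σ (σ z) ≡ z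
  σ-involutive = shift-involutive h⊕h≡0

  σ-fixpoint-free : ∀ z → σ z ≢ z
  σ-fixpoint-free = shift-fixpoint-free h≢0

  σ-preserves : ∀ z → NonZeroProduct 1+i z → NonZeroProduct 1+i (σ z)
  σ-preserves z (inj₁ ≢0) = inj₁ (≢0 ∘ trans (sym (1+i·shift h⊕h≡0 z)))
  σ-preserves z (inj₂ ≢0) = inj₂ (≢0 ∘ trans (sym (shift·1+i h⊕h≡0 z)))

  ¬nonzero-0Q : ¬ NonZeroProduct 1+i 0Q
  ¬nonzero-0Q (inj₁ ≢0) = ≢0 (trans (1+i·-expand 0# 0# 0# 0#)
    (quat-cong (⊖-identityʳ 0#) (⊕-identityʳ 0#) (⊖-identityʳ 0#) (⊕-identityʳ 0#)))
  ¬nonzero-0Q (inj₂ ≢0) = ≢0 (trans (·1+i-expand 0# 0# 0# 0#)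
    (quat-cong (⊖-identityʳ 0#) (⊕-identityʳ 0#) (⊕-identityʳ 0#)
               (trans (cong (_⊕ 0#) (⊖-identityʳ 0#)) (⊕-identityʳ 0#))))

  1+i·-≢0Q : ∀ {a b c d} → a ⊖ b ≢ 0# → 1+i · quat a b c d ≢ 0Q
  1+i·-≢0Q {a} {b} {c} {d} a-b≢0 eq = a-b≢0 (cong Quat.q1 (trans (sym (1+i·-expand a b c d)) eq))

  1+i-vertex : IsVertexΦ (1+i {suc n})
  1+i-vertex = q2≢0 , q2≢0 , q2≢0
    where
    q2≢0 : ∀ {c d} → 1+i ≢ quat {suc n} c 0# d 0#
    q2≢0 eq = 1#≢0# 1<M (cong Quat.q2 eq)

  ExceptionalOrAdjacent : Quat (suc n) → Set
  ExceptionalOrAdjacent z = z ≡ 1Q ⊎ z ≡ -1Q ⊎ z ≡ 1+i ⊎ AdjΦ 1+i z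

  nonzero⇒exceptional-or-adjacent : ∀ z → NonZeroProduct 1+i z → ExceptionalOrAdjacent z
  nonzero⇒exceptional-or-adjacent z nz = go (z ≟ 1Q) (z ≟ -1Q) (z ≟ 1+i) (z ≟ 0Q)
    where
    go : Dec (z ≡ 1Q) → Dec (z ≡ -1Q) → Dec (z ≡ 1+i) → Dec (z ≡ 0Q) → ExceptionalOrAdjacent z
    go (yes z≡1) _          _         _         = inj₁ z≡1
    go (no _)    (yes z≡-1) _         _         = inj₂ (inj₁ z≡-1)
    go (no _)    (no _)     (yes z≡x) _         = inj₂ (inj₂ (inj₁ z≡x))
    go (no _)    (no _)     (no _)    (yes z≡0) =
      contradiction (subst (NonZeroProduct 1+i) z≡0 nz) ¬nonzero-0Q
    go (no z≢1)  (no z≢-1)  (no z≢x)  (no z≢0)  =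
      inj₂ (inj₂ (inj₂ (1+i-vertex , (z≢0 , z≢1 , z≢-1) , z≢x ∘ sym , nz)))

  nonzero-1Q : NonZeroProduct {suc n} 1+i 1Q
  nonzero-1Q = inj₁ (1+i·-≢0Q (1#≢0# 1<M ∘ trans (sym (⊖-identityʳ 1#))))

  nonzero--1Q : NonZeroProduct {suc n} 1+i -1Q
  nonzero--1Q = inj₁ (1+i·-≢0Q (⊝1#≢0# 1<M ∘ trans (sym (⊖-identityʳ (⊝ 1#)))))

  ¬Adj-1Q : ¬ AdjΦ {suc n} 1+i 1Q
  ¬Adj-1Q (_ , (_ , 1Q≢1Q , _) , _) = 1Q≢1Q refl

  ¬Adj--1Q : ¬ AdjΦ {suc n} 1+i -1Q
  ¬Adj--1Q (_ , (_ , _ , -1Q≢-1Q) , _) = -1Q≢-1Q refl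

  ¬Adj-1+i : ¬ AdjΦ {suc n} 1+i 1+i
  ¬Adj-1+i (_ , _ , 1+i≢1+i , _) = 1+i≢1+i refl

  record Exceptional (es : List (Quat (suc n))) : Set where
    field
      unique       : Unique es
      nonzero      : ∀ {z} → z ∈ es → NonZeroProduct 1+i z
      non-adjacent : ∀ {z} → z ∈ es → ¬ AdjΦ 1+i z
      1Q∈          : 1Q ∈ es
      -1Q∈         : -1Q ∈ es
      1+i∈         : NonZeroProduct {suc n} 1+i 1+i → 1+i ∈ es
      odd          : ¬ 2 ∣ length es

  odd-degree : ∀ {es} → Exceptional es → ∀ ns → Neighbourhood (Φ (suc n)) 1+i ns → ¬ 2 ∣ length ns
  odd-degree {es} E ns (unique-ns , adjacent , complete) 2∣ns =
    odd (even-length-complement _≟_ σ σ-involutive σ-fixpoint-free ns es unique-ns unique disjoint closed 2∣ns)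
    where
    open Exceptional E
    disjoint : Disjoint ns es
    disjoint (z∈ns , z∈es) = non-adjacent z∈es (adjacent z∈ns)
    nonzero-all : ∀ {z} → z ∈ ns ++ es → NonZeroProduct 1+i z
    nonzero-all z∈ = [ (λ z∈ns → proj₂ (proj₂ (proj₂ (adjacent z∈ns)))) , nonzero ]′ (∈-++⁻ ns z∈)
    closed : ∀ {z} → z ∈ ns ++ es → σ z ∈ ns ++ es
    closed {z} z∈ = place (nonzero⇒exceptional-or-adjacent (σ z) σz-nonzero)
      where
      σz-nonzero = σ-preserves z (nonzero-all z∈)
      place : ExceptionalOrAdjacent (σ z) → σ z ∈ ns ++ es
      place (inj₁ σz≡1)               = ∈-++⁺ʳ ns (subst (_∈ es) (sym σz≡1) 1Q∈)
      place (inj₂ (inj₁ σz≡-1))       = ∈-++⁺ʳ ns (subst (_∈ es) (sym σz≡-1) -1Q∈)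
      place (inj₂ (inj₂ (inj₁ σz≡x))) =
        ∈-++⁺ʳ ns (subst (_∈ es) (sym σz≡x) (1+i∈ (subst (NonZeroProduct {suc n} 1+i) σz≡x σz-nonzero)))
      place (inj₂ (inj₂ (inj₂ adj)))  = ∈-++⁺ˡ (complete adj)

-- In ℤ₂ both -1 = 1 and (1 + i)² = 2i = 0 hold by computation.
exceptional-N=1 : OddDegree.Exceptional 0 (1Q ∷ [])
exceptional-N=1 = record
  { unique       = [] ∷ []
  ; nonzero      = λ { (here refl) → nonzero-1Q }
  ; non-adjacent = λ { (here refl) → ¬Adj-1Q }
  ; 1Q∈          = here refl
  ; -1Q∈         = here refl
  ; 1+i∈         = λ { (inj₁ ≢0) → contradiction refl ≢0 ; (inj₂ ≢0) → contradiction refl ≢0 }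
  ; odd          = λ 2∣1 → contradiction (n∣m⇒m%n≡0 1 2 2∣1) λ ()
  }
  where open OddDegree 0

exceptional-N≥2 : ∀ m → OddDegree.Exceptional (suc m) (1Q ∷ -1Q ∷ 1+i ∷ [])
exceptional-N≥2 m = record
  { unique       = (1Q≢-1Q ∷ 1Q≢1+i ∷ []) ∷ (-1Q≢1+i ∷ []) ∷ [] ∷ []
  ; nonzero      = λ { (here refl) → nonzero-1Q ; (there (here refl)) → nonzero--1Q
                     ; (there (there (here refl))) → nonzero-1+i }
  ; non-adjacent = λ { (here refl) → ¬Adj-1Q ; (there (here refl)) → ¬Adj--1Q
                     ; (there (there (here refl))) → ¬Adj-1+i }
  ; 1Q∈          = here refl
  ; -1Q∈         = there (here refl)
  ; 1+i∈         = λ _ → there (there (here refl))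
  ; odd          = λ 2∣3 → contradiction (n∣m⇒m%n≡0 3 2 2∣3) λ ()
  }
  where
  open Residues (suc (suc m))
  open QuaternionFacts (suc (suc m))
  open OddDegree (suc m)
  2<M : 2 < M
  2<M = ℕ.≤-trans (ℕ.n≤1+n 3) (ℕ.*-monoʳ-≤ 2 (ℕ.*-monoʳ-≤ 2 (ℕ.m^n>0 2 m)))
  1Q≢-1Q : 1Q {suc (suc m)} ≢ -1Q
  1Q≢-1Q = 1#≢⊝1# 2<M ∘ cong Quat.q1
  1Q≢1+i : 1Q {suc (suc m)} ≢ 1+i
  1Q≢1+i = 1#≢0# 1<M ∘ sym ∘ cong Quat.q2
  -1Q≢1+i : -1Q {suc (suc m)} ≢ 1+i
  -1Q≢1+i = 1#≢0# 1<M ∘ sym ∘ cong Quat.q2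
  nonzero-1+i : NonZeroProduct {suc (suc m)} 1+i 1+i
  nonzero-1+i = inj₁ λ eq → 1#⊕1#≢0# 2<M (cong Quat.q2 (trans (sym (1+i·-expand 1# 1# 0# 0#)) eq))

exceptional : ∀ n → ∃ (OddDegree.Exceptional n)
exceptional zero    = -, exceptional-N=1
exceptional (suc m) = -, exceptional-N≥2 m

proposition4p6 : ∀ (n : ℕ) → ¬ Eulerian (Φ (suc n))
proposition4p6 n eulerian =
  let ns , neighbourhood , even-degree =
        EulerianDegree.eulerian⇒even-degree (Φ (suc n)) _≟_ AdjΦ-sym AdjΦ-irrefl eulerian 1+i
      _ , exceptional-elements = exceptional n
  in OddDegree.odd-degree n exceptional-elements ns neighbourhood even-degree
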